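{- Let $p\ge1$, $n\ge 2p+2$, and $1\le i\le p$. Let $\mathcal{C}_0,\mathcal{C}_1,\dots$ be the sets defined below for $\Delta_2^t(C_n^p)$ with the vertex order $x_j=j$, and let $\mathcal{X}_i=\{i+p+1,i+p+2,\dots,i+n-p-1\}$. If $\sigma\in\mathcal{C}_i$, then $\sigma\in\mathcal{C}_{i+1}$ if and only if $\{1,2,\dots,i\}\subseteq\sigma$ and $\mathcal{X}_i\not\subseteq\sigma$.
   Context: For a graph $G$, $\Delta_2^t(G)$ is the simplicial complex whose faces are the $\sigma\subseteq V(G)$ such that $V(G)\setminus\sigma$ contains two distinct non-adjacent vertices (its facets have size $|V(G)|-2$). $C_n^p$ has vertex set $\{0,\dots,n-1\}$ with distinct $u,v$ adjacent iff $v\equiv u\pm t\pmod n$ for some $1\le t\le p$. Sequence of element matchings: given vertices $x_0,\dots,x_{n-1}$, set $\mathcal{C}_0=\Delta_2^t(G)$ and for $0\le j\le n-1$ put $\mathcal{M}_{x_j}=\{\{\sigma\setminus\{x_j\},\sigma\cup\{x_j\}\}\mid \sigma\setminus\{x_j\},\sigma\cup\{x_j\}\in\mathcal{C}_j\}$ and $\mathcal{C}_{j+1}=\{\sigma\in\mathcal{C}_j\mid \sigma\text{ lies in no pair of }\mathcal{M}_{x_j}\}$. Here $G=C_n^p$ and $x_j=j$. -}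

module Defs where

open import Data.Nat using (ℕ; zero; suc; _+_; _≤_; NonZero; _%_)
open import Data.Nat.DivMod using (_mod_)
open import Data.Fin using (Fin; toℕ)
open import Data.Fin.Subset using (Subset; _∉_; _∪_; ⁅_⁆; _-_)
open import Data.Product using (_×_; ∃; ∃-syntax)
open import Data.Sum using (_⊎_)
open import Relation.Nullary using (¬_)
open import Relation.Binary.PropositionalEquality using (_≡_; _≢_)

-- Adjacency in C_n^p on vertex set {0,…,n-1} (= Fin n):
-- distinct u, v adjacent iff v ≡ u ± t (mod n) for some 1 ≤ t ≤ p.
-- (v ≡ u - t  is written as  u ≡ v + t.)
CircAdj : (n p : ℕ) .{{_ : NonZero n}} → Fin n → Fin n → Set
CircAdj n p u v =
  u ≢ v × ∃[ t ] (1 ≤ t × t ≤ p ×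
    (((toℕ u + t) % n ≡ toℕ v) ⊎ ((toℕ v + t) % n ≡ toℕ u)))

Δ₂ᵗ : {n : ℕ} → (Fin n → Fin n → Set) → Subset n → Set
Δ₂ᵗ {n} Adj σ = ∃[ u ] ∃[ v ] (u ≢ v × u ∉ σ × v ∉ σ × ¬ Adj u v)

-- Sequence of element matchings for a complex (given by its face predicate)
-- and a vertex order x₀, x₁, … .
--   C₀ = complex,
--   C_{j+1} = { σ ∈ C_j | σ lies in no pair {σ∖x_j, σ∪x_j} with both in C_j }.
-- σ lies in such a pair iff σ∖{x_j} ∈ C_j and σ∪{x_j} ∈ C_j (σ is one of them).
MatchSeq : {n : ℕ} → (Subset n → Set) → (ℕ → Fin n) → ℕ → Subset n → Set
MatchSeq K x zero σ = K σ
MatchSeq K x (suc j) σ =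
  MatchSeq K x j σ × ¬ (MatchSeq K x j (σ - x j) × MatchSeq K x j (σ ∪ ⁅ x j ⁆))

-- Vertex order x_j = j (taken mod n, which only matters for j ≥ n, never used).
natOrder : (n : ℕ) .{{_ : NonZero n}} → ℕ → Fin n
natOrder n j = j mod n

𝒞 : (n p : ℕ) .{{_ : NonZero n}} → ℕ → Subset n → Set
𝒞 n p = MatchSeq (Δ₂ᵗ (CircAdj n p)) (natOrder n)

module Submission where

-- For j ≤ p the non-neighbours of the vertex j of C_n^p are exactly the vertices of the window
-- X_j = {j+p+1, …, j+n−p−1}, all of which lie above p.  By induction on j, a face σ lies in 𝒞_j
-- (1 ≤ j ≤ p+1) iff σ ∪ {0} is not a face (every non-edge missing from σ passes through 0),
-- 1, …, j−1 ∈ σ, and X_k ⊈ σ for 1 ≤ k < j.  For such σ: if j ∉ σ, then σ ∪ {j} has the same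
-- properties, as j ≠ 0 while every window and every non-neighbour of 0 lies above p; if j ∈ σ, then
-- σ − j has them exactly when X_j ⊆ σ, because its new missing non-edges are the pairs {j, v} with
-- v ∈ X_j ∖ σ.  So σ stays unmatched at step j iff j ∈ σ and X_j ⊈ σ.

open import Defs
open import Data.Nat
  using (ℕ; zero; suc; _+_; _*_; _∸_; _≤_; _<_; NonZero; >-nonZero; _%_; _/_; z≤n; s≤s; s≤s⁻¹)
open import Data.Nat.Properties hiding (_≟_)
open import Data.Nat.DivMod using (m≡m%n+[m/n]*n; [m+n]%n≡m%n; m<n⇒m%n≡m)
open import Data.Fin using (Fin; toℕ)
open import Data.Fin.Properties using (toℕ<n; toℕ-fromℕ<; toℕ-injective; _≟_)
open import Data.Fin.Subset using (Subset; _∈_; _∉_; _⊆_; _∪_; _─_; _-_; ⁅_⁆)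
open import Data.Fin.Subset.Properties
  using (_∈?_; ⊆-antisym; p⊆p∪q; x∈p∪q⁻; x∈p∪q⁺; x∈⁅x⁆; x∈⁅y⁆⇒x≡y; p─q⊆p; x∈p∧x≢y⇒x∈p-y)
open import Data.Vec.Base using (_∷_; here; there)
open import Data.Product using (_×_; _,_; proj₁; proj₂)
open import Data.Product.Function.NonDependent.Propositional using (_×-⇔_)
open import Data.Product.Function.Dependent.Propositional using (Σ-⇔)
open import Data.Sum using (inj₁; inj₂; _⊎_; [_,_]′)
open import Data.Empty using (⊥; ⊥-elim)
open import Function.Base using (_∘_; flip)
open import Function.Bundles using (_⇔_; mk⇔; Equivalence)
open import Function.Construct.Identity using (↠-id)
open import Function.Properties.Equivalence using () renaming (sym to ⇔-sym)
open import Function.Related.TypeIsomorphisms using (¬-cong-⇔)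
open import Function.Related.Propositional using (module EquationalReasoning)
open import Relation.Nullary using (¬_; yes; no)
open import Relation.Binary.Definitions using (tri<; tri≈; tri>)
open import Relation.Binary.PropositionalEquality using (_≡_; _≢_; refl; sym; trans; cong; subst)

module _ where

  private variable
    n : ℕ
    p q σ τ : Subset n
    x y : Fin n
    Adj : Fin n → Fin n → Set

  x∈q⇒x∉p─q : ∀ {n} {p q : Subset n} {x} → x ∈ q → x ∉ p ─ q
  x∈q⇒x∉p─q {p = _ ∷ p} {_ ∷ q} here        ()
  x∈q⇒x∉p─q {p = _ ∷ p} {_ ∷ q} (there x∈q) (there x∈p─q) = x∈q⇒x∉p─q x∈q x∈p─q

  x∉p-x : x ∉ p - x
  x∉p-x {x = x} = x∈q⇒x∉p─q (x∈⁅x⁆ x)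

  x∈p∪⁅y⁆∧x≢y⇒x∈p : x ∈ p ∪ ⁅ y ⁆ → x ≢ y → x ∈ p
  x∈p∪⁅y⁆∧x≢y⇒x∈p {p = p} {y = y} x∈ x≢y with x∈p∪q⁻ p ⁅ y ⁆ x∈
  ... | inj₁ x∈p   = x∈p
  ... | inj₂ x∈⁅y⁆ = ⊥-elim (x≢y (x∈⁅y⁆⇒x≡y y x∈⁅y⁆))

  x∉p∧x≢y⇒x∉p∪⁅y⁆ : x ∉ p → x ≢ y → x ∉ p ∪ ⁅ y ⁆
  x∉p∧x≢y⇒x∉p∪⁅y⁆ x∉p x≢y x∈ = x∉p (x∈p∪⁅y⁆∧x≢y⇒x∈p x∈ x≢y)

  x∈p⇒p∪⁅x⁆≡p : x ∈ p → p ∪ ⁅ x ⁆ ≡ p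
  x∈p⇒p∪⁅x⁆≡p {x = x} {p = p} x∈p = ⊆-antisym ∪⁅x⁆⊆p (p⊆p∪q ⁅ x ⁆)
    where
    ∪⁅x⁆⊆p : p ∪ ⁅ x ⁆ ⊆ p
    ∪⁅x⁆⊆p y∈ with x∈p∪q⁻ p ⁅ x ⁆ y∈
    ... | inj₁ y∈p   = y∈p
    ... | inj₂ y∈⁅x⁆ = subst (_∈ p) (sym (x∈⁅y⁆⇒x≡y x y∈⁅x⁆)) x∈p

  x∉p⇒p-x≡p : x ∉ p → p - x ≡ p
  x∉p⇒p-x≡p {x = x} {p = p} x∉p =
    ⊆-antisym (p─q⊆p p ⁅ x ⁆) (λ y∈p → x∈p∧x≢y⇒x∈p-y y∈p λ { refl → x∉p y∈p })

  NonEdgesMeet : (Fin n → Fin n → Set) → Fin n → Subset n → Set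
  NonEdgesMeet Adj y σ = ∀ {u v} → u ≢ v → u ∉ σ → v ∉ σ → ¬ Adj u v → u ≡ y ⊎ v ≡ y

  Δ₂ᵗ-antitone : σ ⊆ τ → Δ₂ᵗ Adj τ → Δ₂ᵗ Adj σ
  Δ₂ᵗ-antitone σ⊆τ (u , v , u≢v , u∉τ , v∉τ , u≁v) = u , v , u≢v , u∉τ ∘ σ⊆τ , v∉τ ∘ σ⊆τ , u≁v

  ¬Δ₂ᵗ-∪⁅⁆⇔NonEdgesMeet : (¬ Δ₂ᵗ Adj (σ ∪ ⁅ y ⁆)) ⇔ NonEdgesMeet Adj y σ
  ¬Δ₂ᵗ-∪⁅⁆⇔NonEdgesMeet {Adj = Adj} {σ = σ} {y = y} = mk⇔ to from
    where
    to : ¬ Δ₂ᵗ Adj (σ ∪ ⁅ y ⁆) → NonEdgesMeet Adj y σ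
    to ¬face {u} {v} u≢v u∉σ v∉σ u≁v with u ≟ y | v ≟ y
    ... | yes u≡y | _       = inj₁ u≡y
    ... | no _    | yes v≡y = inj₂ v≡y
    ... | no u≢y  | no v≢y  =
      ⊥-elim (¬face (u , v , u≢v , x∉p∧x≢y⇒x∉p∪⁅y⁆ u∉σ u≢y , x∉p∧x≢y⇒x∉p∪⁅y⁆ v∉σ v≢y , u≁v))
    y∉σ∪⁅y⁆ : ∀ {u} → u ≡ y → u ∉ σ ∪ ⁅ y ⁆ → ⊥
    y∉σ∪⁅y⁆ refl u∉ = u∉ (x∈p∪q⁺ (inj₂ (x∈⁅x⁆ y)))
    from : NonEdgesMeet Adj y σ → ¬ Δ₂ᵗ Adj (σ ∪ ⁅ y ⁆)
    from meet (u , v , u≢v , u∉ , v∉ , u≁v) with meet u≢v (u∉ ∘ p⊆p∪q _) (v∉ ∘ p⊆p∪q _) u≁v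
    ... | inj₁ u≡y = y∉σ∪⁅y⁆ u≡y u∉
    ... | inj₂ v≡y = y∉σ∪⁅y⁆ v≡y v∉

  Matched : (Subset n → Set) → Fin n → Subset n → Set
  Matched C x σ = C (σ - x) × C (σ ∪ ⁅ x ⁆)

  MatchSeq-suc-cong : ∀ {K P : Subset n → Set} {x : ℕ → Fin n} {j} →
    (∀ τ → MatchSeq K x j τ ⇔ P τ) → ∀ σ → MatchSeq K x (suc j) σ ⇔ (P σ × ¬ Matched P (x j) σ)
  MatchSeq-suc-cong {x = x} {j} C⇔P σ =
    C⇔P σ ×-⇔ ¬-cong-⇔ (C⇔P (σ - x j) ×-⇔ C⇔P (σ ∪ ⁅ x j ⁆))

module Circulant (n p : ℕ) .{{_ : NonZero n}} (p+p<n : p + p < n) where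

  _~_ : Fin n → Fin n → Set
  u ~ v = CircAdj n p u v

  x : ℕ → Fin n
  x = natOrder n

  InWindow : ℕ → Fin n → Set
  InWindow k v = k + p + 1 ≤ toℕ v × toℕ v ≤ k + n ∸ p ∸ 1

  private variable
    j k : ℕ
    a u v : Fin n

  p<n : p < n
  p<n = ≤-<-trans (m≤m+n p p) p+p<n

  toℕ-x : j < n → toℕ (x j) ≡ j
  toℕ-x j<n = trans (toℕ-fromℕ< _) (m<n⇒m%n≡m j<n)

  ~-sym : u ~ v → v ~ u
  ~-sym (u≢v , t , 1≤t , t≤p , inj₁ e) = u≢v ∘ sym , t , 1≤t , t≤p , inj₂ e
  ~-sym (u≢v , t , 1≤t , t≤p , inj₂ e) = u≢v ∘ sym , t , 1≤t , t≤p , inj₁ e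

  ~-forward : toℕ u < toℕ v → toℕ v ≤ toℕ u + p → u ~ v
  ~-forward {u} {v} u<v v≤u+p =
    (λ u≡v → <-irrefl (cong toℕ u≡v) u<v) , toℕ v ∸ toℕ u ,
    m<n⇒0<n∸m u<v , m≤n+o⇒m∸n≤o (toℕ v) (toℕ u) v≤u+p ,
    inj₁ (trans (cong (_% n) (m+[n∸m]≡n (<⇒≤ u<v))) (m<n⇒m%n≡m (toℕ<n v)))

  ~-wrap : toℕ u + n ≤ toℕ v + p → u ~ v
  ~-wrap {u} {v} u+n≤v+p =
    u≢v , toℕ u + n ∸ toℕ v ,
    m<n⇒0<n∸m v<u+n , m≤n+o⇒m∸n≤o (toℕ u + n) (toℕ v) u+n≤v+p ,
    inj₂ (trans (cong (_% n) (m+[n∸m]≡n (<⇒≤ v<u+n)))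
                (trans ([m+n]%n≡m%n (toℕ u) n) (m<n⇒m%n≡m (toℕ<n u))))
    where
    v<u+n : toℕ v < toℕ u + n
    v<u+n = <-≤-trans (toℕ<n v) (m≤n+m n (toℕ u))
    u≢v : u ≢ v
    u≢v refl = <⇒≱ p<n (+-cancelˡ-≤ (toℕ u) n p u+n≤v+p)

  ≁⇒far : toℕ a ≤ p → a ≢ v → ¬ a ~ v → toℕ a + p < toℕ v × toℕ v + p < toℕ a + n
  ≁⇒far {a} {v} a≤p a≢v a≁v = above , below
    where
    above : toℕ a + p < toℕ v
    above with <-≤-connex (toℕ a + p) (toℕ v) | <-cmp (toℕ v) (toℕ a)
    ... | inj₁ a+p<v | _           = a+p<v
    ... | inj₂ v≤a+p | tri< v<a _ _ =
      ⊥-elim (a≁v (~-sym (~-forward v<a (≤-trans a≤p (m≤n+m p (toℕ v))))))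
    ... | inj₂ v≤a+p | tri≈ _ v≡a _ = ⊥-elim (a≢v (toℕ-injective (sym v≡a)))
    ... | inj₂ v≤a+p | tri> _ _ a<v = ⊥-elim (a≁v (~-forward a<v v≤a+p))
    below : toℕ v + p < toℕ a + n
    below with <-≤-connex (toℕ v + p) (toℕ a + n)
    ... | inj₁ v+p<a+n = v+p<a+n
    ... | inj₂ a+n≤v+p = ⊥-elim (a≁v (~-wrap a+n≤v+p))

  far⇒≁ : toℕ a ≤ p → toℕ a + p < toℕ v → toℕ v + p < toℕ a + n → ¬ a ~ v
  far⇒≁ {a} {v} a≤p a+p<v v+p<a+n (_ , t , _ , t≤p , inj₁ e) =
    <⇒≱ a+p<v (≤-trans (≤-reflexive (trans (sym e) (m<n⇒m%n≡m a+t<n))) (+-monoʳ-≤ (toℕ a) t≤p))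
    where
    a+t<n : toℕ a + t < n
    a+t<n = ≤-<-trans (+-mono-≤ a≤p t≤p) p+p<n
  far⇒≁ {a} {v} a≤p a+p<v v+p<a+n (_ , t , _ , t≤p , inj₂ e) =
    wrapped ((toℕ v + t) / n) (trans (m≡m%n+[m/n]*n (toℕ v + t) n) (cong (_+ _) e))
    where
    wrapped : ∀ q → toℕ v + t ≡ toℕ a + q * n → ⊥
    wrapped zero    e′ = <⇒≱ (≤-<-trans (m≤m+n (toℕ a) p) a+p<v)
                             (≤-trans (m≤m+n (toℕ v) t) (≤-reflexive (trans e′ (+-identityʳ (toℕ a)))))
    wrapped (suc q) e′ = <⇒≱ v+p<a+n
      (≤-trans (+-monoʳ-≤ (toℕ a) (m≤m+n n (q * n)))
               (≤-trans (≤-reflexive (sym e′)) (+-monoʳ-≤ (toℕ v) t≤p)))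

  InWindow⇔far : InWindow k v ⇔ (k + p < toℕ v × toℕ v + p < k + n)
  InWindow⇔far {k} {v} = mk⇔ (λ (l , u) → lower⁺ l , upper⁺ u) (λ (l , u) → lower⁻ l , upper⁻ u)
    where
    p<k+n : p < k + n
    p<k+n = <-≤-trans p<n (m≤n+m n k)
    instance
      _ : NonZero (k + n ∸ p)
      _ = >-nonZero (m<n⇒0<n∸m p<k+n)
    lower⁺ : k + p + 1 ≤ toℕ v → k + p < toℕ v
    lower⁺ = subst (_≤ toℕ v) (+-comm (k + p) 1)
    lower⁻ : k + p < toℕ v → k + p + 1 ≤ toℕ v
    lower⁻ = subst (_≤ toℕ v) (+-comm 1 (k + p))
    upper⁺ : toℕ v ≤ k + n ∸ p ∸ 1 → toℕ v + p < k + n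
    upper⁺ = m≤o∸n⇒m+n≤o (suc (toℕ v)) (<⇒≤ p<k+n) ∘ m≤pred[n]⇒suc[m]≤n
    upper⁻ : toℕ v + p < k + n → toℕ v ≤ k + n ∸ p ∸ 1
    upper⁻ = suc[m]≤n⇒m≤pred[n] ∘ m+n≤o⇒m≤o∸n (suc (toℕ v))

  ≁⇒InWindow : toℕ a ≤ p → a ≢ v → ¬ a ~ v → InWindow (toℕ a) v
  ≁⇒InWindow a≤p a≢v a≁v = Equivalence.from InWindow⇔far (≁⇒far a≤p a≢v a≁v)

  InWindow⇒≁ : toℕ a ≤ p → InWindow (toℕ a) v → ¬ a ~ v
  InWindow⇒≁ a≤p w = let (above , below) = Equivalence.to InWindow⇔far w in far⇒≁ a≤p above below

  InWindow⇒≢ : toℕ a ≤ p → InWindow k v → v ≢ a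
  InWindow⇒≢ {a} {k} a≤p w refl =
    <⇒≱ (≤-<-trans (m≤n+m p k) (proj₁ (Equivalence.to InWindow⇔far w))) a≤p

  Face : Subset n → Set
  Face = Δ₂ᵗ _~_

  Prefix≤ : ℕ → Subset n → Set
  Prefix≤ j σ = ∀ v → 1 ≤ toℕ v → toℕ v ≤ j → v ∈ σ

  Window⊆ : ℕ → Subset n → Set
  Window⊆ k σ = ∀ v → k + p + 1 ≤ toℕ v → toℕ v ≤ k + n ∸ p ∸ 1 → v ∈ σ

  record Survives (j : ℕ) (σ : Subset n) : Set where
    field
      face           : Face σ
      non-edges-meet : NonEdgesMeet _~_ (x 0) σ
      prefix         : ∀ v → 1 ≤ toℕ v → toℕ v < j → v ∈ σ
      windows        : ∀ k → 1 ≤ k → k < j → ¬ Window⊆ k σ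
  open Survives

  private variable
    σ τ : Subset n

  toℕ-x0 : toℕ (x 0) ≡ 0
  toℕ-x0 = toℕ-x (≤-<-trans z≤n p<n)

  x0≤p : toℕ (x 0) ≤ p
  x0≤p = subst (_≤ p) (sym toℕ-x0) z≤n

  x0≢ : 1 ≤ toℕ a → x 0 ≢ a
  x0≢ 1≤a refl = <⇒≱ 1≤a (≤-reflexive toℕ-x0)

  face-insert : 1 ≤ toℕ a → toℕ a ≤ p → Face σ → NonEdgesMeet _~_ (x 0) σ → Face (σ ∪ ⁅ a ⁆)
  face-insert {a} 1≤a a≤p (u , v , u≢v , u∉σ , v∉σ , u≁v) meet with meet u≢v u∉σ v∉σ u≁v
  ... | inj₁ refl = u , v , u≢v , x∉p∧x≢y⇒x∉p∪⁅y⁆ u∉σ (x0≢ 1≤a) ,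
                    x∉p∧x≢y⇒x∉p∪⁅y⁆ v∉σ (InWindow⇒≢ a≤p (≁⇒InWindow x0≤p u≢v u≁v)) , u≁v
  ... | inj₂ refl = u , v , u≢v ,
                    x∉p∧x≢y⇒x∉p∪⁅y⁆ u∉σ (InWindow⇒≢ a≤p (≁⇒InWindow x0≤p (u≢v ∘ sym) (u≁v ∘ ~-sym))) ,
                    x∉p∧x≢y⇒x∉p∪⁅y⁆ v∉σ (x0≢ 1≤a) , u≁v

  Window⊆-mono : σ ⊆ τ → Window⊆ k σ → Window⊆ k τ
  Window⊆-mono σ⊆τ W v lower upper = σ⊆τ (W v lower upper)

  Window⊆-insert⁻ : toℕ a ≤ p → Window⊆ k (σ ∪ ⁅ a ⁆) → Window⊆ k σ
  Window⊆-insert⁻ a≤p W v lower upper =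
    x∈p∪⁅y⁆∧x≢y⇒x∈p (W v lower upper) (InWindow⇒≢ a≤p (lower , upper))

  survives-insert : 1 ≤ toℕ a → toℕ a ≤ p → Survives j σ → Survives j (σ ∪ ⁅ a ⁆)
  survives-insert 1≤a a≤p s = record
    { face           = face-insert 1≤a a≤p (face s) (non-edges-meet s)
    ; non-edges-meet = λ u≢v u∉ v∉ → non-edges-meet s u≢v (u∉ ∘ p⊆p∪q _) (v∉ ∘ p⊆p∪q _)
    ; prefix         = λ v 1≤v v<j → p⊆p∪q _ (prefix s v 1≤v v<j)
    ; windows        = λ k 1≤k k<j → windows s k 1≤k k<j ∘ Window⊆-insert⁻ a≤p
    }

  module _ {j : ℕ} (1≤j : 1 ≤ j) (j≤p : j ≤ p) where

    private
      toℕ-xj : toℕ (x j) ≡ j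
      toℕ-xj = toℕ-x (≤-<-trans j≤p p<n)

      xj≤p : toℕ (x j) ≤ p
      xj≤p = subst (_≤ p) (sym toℕ-xj) j≤p

      1≤xj : 1 ≤ toℕ (x j)
      1≤xj = subst (1 ≤_) (sym toℕ-xj) 1≤j

      ≁xj⇒InWindow : x j ≢ v → ¬ x j ~ v → InWindow j v
      ≁xj⇒InWindow xj≢v xj≁v = subst (λ k → InWindow k _) toℕ-xj (≁⇒InWindow xj≤p xj≢v xj≁v)

      InWindow⇒≁xj : InWindow j v → ¬ x j ~ v
      InWindow⇒≁xj w = InWindow⇒≁ xj≤p (subst (λ k → InWindow k _) (sym toℕ-xj) w)

    survives-remove : Window⊆ j σ → Survives j σ → Survives j (σ - x j)
    survives-remove {σ} W s = record
      { face           = Δ₂ᵗ-antitone (p─q⊆p σ _) (face s)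
      ; non-edges-meet = meet
      ; prefix         = λ v 1≤v v<j →
                           x∈p∧x≢y⇒x∈p-y (prefix s v 1≤v v<j) (λ { refl → <-irrefl toℕ-xj v<j })
      ; windows        = λ k 1≤k k<j → windows s k 1≤k k<j ∘ Window⊆-mono (p─q⊆p σ _)
      }
      where
      neighbour∈ : x j ≢ v → ¬ x j ~ v → v ∈ σ - x j
      neighbour∈ xj≢v xj≁v = let (lower , upper) = ≁xj⇒InWindow xj≢v xj≁v in
        x∈p∧x≢y⇒x∈p-y (W _ lower upper) (xj≢v ∘ sym)
      meet : NonEdgesMeet _~_ (x 0) (σ - x j)
      meet {u} {v} u≢v u∉ v∉ u≁v with u ≟ x j | v ≟ x j
      ... | yes refl | _        = ⊥-elim (v∉ (neighbour∈ u≢v u≁v))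
      ... | no _     | yes refl = ⊥-elim (u∉ (neighbour∈ (u≢v ∘ sym) (u≁v ∘ ~-sym)))
      ... | no u≢xj  | no v≢xj  =
        non-edges-meet s u≢v (u∉ ∘ flip x∈p∧x≢y⇒x∈p-y u≢xj) (v∉ ∘ flip x∈p∧x≢y⇒x∈p-y v≢xj) u≁v

    NonEdgesMeet⇒Window⊆ : NonEdgesMeet _~_ (x 0) (σ - x j) → Window⊆ j σ
    NonEdgesMeet⇒Window⊆ {σ} meet v lower upper with v ∈? σ
    ... | yes v∈σ = v∈σ
    ... | no  v∉σ = ⊥-elim ([ x0≢ 1≤xj ∘ sym , InWindow⇒≢ x0≤p window ]′
                               (meet (v≢xj ∘ sym) x∉p-x (v∉σ ∘ p─q⊆p σ _) (InWindow⇒≁xj window)))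
      where
      window : InWindow j v
      window = lower , upper
      v≢xj : v ≢ x j
      v≢xj = InWindow⇒≢ xj≤p window

    unmatched⇔ : Survives j σ → (¬ Matched (Survives j) (x j) σ) ⇔ (Prefix≤ j σ × ¬ Window⊆ j σ)
    unmatched⇔ {σ} s = mk⇔ to from
      where
      to : ¬ Matched (Survives j) (x j) σ → Prefix≤ j σ × ¬ Window⊆ j σ
      to unmatched =
        prefix≤ , λ W → unmatched (survives-remove W s , subst (Survives j) (sym (x∈p⇒p∪⁅x⁆≡p xj∈σ)) s)
        where
        xj∈σ : x j ∈ σ
        xj∈σ with x j ∈? σ
        ... | yes xj∈σ = xj∈σ
        ... | no  xj∉σ =
          ⊥-elim (unmatched (subst (Survives j) (sym (x∉p⇒p-x≡p xj∉σ)) s , survives-insert 1≤xj xj≤p s))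
        prefix≤ : Prefix≤ j σ
        prefix≤ v 1≤v v≤j with m≤n⇒m<n∨m≡n v≤j
        ... | inj₁ v<j = prefix s v 1≤v v<j
        ... | inj₂ v≡j = subst (_∈ σ) (toℕ-injective (trans toℕ-xj (sym v≡j))) xj∈σ
      from : Prefix≤ j σ × ¬ Window⊆ j σ → ¬ Matched (Survives j) (x j) σ
      from (_ , ¬W) (s₋ , _) = ¬W (NonEdgesMeet⇒Window⊆ (non-edges-meet s₋))

  Survives-suc⇔ : 1 ≤ j → Survives (suc j) σ ⇔ (Survives j σ × Prefix≤ j σ × ¬ Window⊆ j σ)
  Survives-suc⇔ {j} {σ} 1≤j = mk⇔ to from
    where
    to : Survives (suc j) σ → Survives j σ × Prefix≤ j σ × ¬ Window⊆ j σ
    to s = record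
      { face           = face s
      ; non-edges-meet = non-edges-meet s
      ; prefix         = λ v 1≤v v<j → prefix s v 1≤v (m<n⇒m<1+n v<j)
      ; windows        = λ k 1≤k k<j → windows s k 1≤k (m<n⇒m<1+n k<j)
      } , (λ v 1≤v v≤j → prefix s v 1≤v (s≤s v≤j)) , windows s j 1≤j (n<1+n j)
    from : Survives j σ × Prefix≤ j σ × ¬ Window⊆ j σ → Survives (suc j) σ
    from (s , prefix≤ , ¬W) = record
      { face           = face s
      ; non-edges-meet = non-edges-meet s
      ; prefix         = λ v 1≤v v<1+j → prefix≤ v 1≤v (s≤s⁻¹ v<1+j)
      ; windows        = windows′
      }
      where
      windows′ : ∀ k → 1 ≤ k → k < suc j → ¬ Window⊆ k σ
      windows′ k 1≤k k<1+j with m<1+n⇒m<n∨m≡n k<1+j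
      ... | inj₁ k<j  = windows s k 1≤k k<j
      ... | inj₂ refl = ¬W

  𝒞₁⇔Survives₁ : ∀ σ → 𝒞 n p 1 σ ⇔ Survives 1 σ
  𝒞₁⇔Survives₁ σ = mk⇔ to from
    where
    to : 𝒞 n p 1 σ → Survives 1 σ
    to (f , unmatched) = record
      { face           = f
      ; non-edges-meet = Equivalence.to ¬Δ₂ᵗ-∪⁅⁆⇔NonEdgesMeet
                           (λ f∪ → unmatched (Δ₂ᵗ-antitone (p─q⊆p σ _) f , f∪))
      ; prefix         = λ v 1≤v v<1 → ⊥-elim (<⇒≱ v<1 1≤v)
      ; windows        = λ k 1≤k k<1 → ⊥-elim (<⇒≱ k<1 1≤k)
      }
    from : Survives 1 σ → 𝒞 n p 1 σ
    from s = face s , Equivalence.from ¬Δ₂ᵗ-∪⁅⁆⇔NonEdgesMeet (non-edges-meet s) ∘ proj₂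

  𝒞⇔Survives : ∀ j → 1 ≤ j → j ≤ suc p → ∀ σ → 𝒞 n p j σ ⇔ Survives j σ
  𝒞⇔Survives 1             _ _        = 𝒞₁⇔Survives₁
  𝒞⇔Survives (suc (suc j)) _ (s≤s j<p) σ = begin
    𝒞 n p (suc (suc j)) σ
      ∼⟨ MatchSeq-suc-cong {K = Face} {x = x} (𝒞⇔Survives (suc j) (s≤s z≤n) (m≤n⇒m≤1+n j<p)) σ ⟩
    (Survives (suc j) σ × ¬ Matched (Survives (suc j)) (x (suc j)) σ)
      ∼⟨ Σ-⇔ (↠-id _) (λ {s} → unmatched⇔ (s≤s z≤n) j<p s) ⟩
    (Survives (suc j) σ × Prefix≤ (suc j) σ × ¬ Window⊆ (suc j) σ)
      ∼⟨ ⇔-sym (Survives-suc⇔ (s≤s z≤n)) ⟩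
    Survives (suc (suc j)) σ ∎
    where open EquationalReasoning

proposition3p3 : (p n i : ℕ) .{{_ : NonZero n}} → 1 ≤ p → 2 * p + 2 ≤ n → 1 ≤ i → i ≤ p →
    (σ : Subset n) → 𝒞 n p i σ →
    (𝒞 n p (i + 1) σ ⇔
      (((v : Fin n) → 1 ≤ toℕ v → toℕ v ≤ i → v ∈ σ) ×
       ¬ ((v : Fin n) → i + p + 1 ≤ toℕ v → toℕ v ≤ i + n ∸ p ∸ 1 → v ∈ σ)))
proposition3p3 p n i _ 2p+2≤n 1≤i i≤p σ σ∈𝒞ᵢ rewrite +-comm i 1 = begin
  𝒞 n p (suc i) σ
    ∼⟨ 𝒞⇔Survives (suc i) (s≤s z≤n) (s≤s i≤p) σ ⟩
  Survives (suc i) σ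
    ∼⟨ Survives-suc⇔ 1≤i ⟩
  (Survives i σ × Prefix≤ i σ × ¬ Window⊆ i σ)
    ∼⟨ mk⇔ proj₂ (Equivalence.to (𝒞⇔Survives i 1≤i (m≤n⇒m≤1+n i≤p) σ) σ∈𝒞ᵢ ,_) ⟩
  (Prefix≤ i σ × ¬ Window⊆ i σ) ∎
  where
  p+p<n : p + p < n
  p+p<n = <-≤-trans (m<m+n (p + p) (s≤s z≤n))
                    (subst (λ m → m + 2 ≤ n) (cong (p +_) (+-identityʳ p)) 2p+2≤n)
  open Circulant n p p+p<n
  open EquationalReasoning
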